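{- Let $a(n,m)$ denote the number of Arndt compositions of $n$ with exactly $m$ parts. For all integers $n,m\ge 0$, $$\left(m-n-2+\lfloor m/2\rfloor\right)a(n+2,m) + \left(m-\lfloor m/2\rfloor\right)a(n+1,m) + n\,a(n,m)=0.$$
   Context: A composition of $n\ge 0$ is a finite sequence $(\sigma_1,\dots,\sigma_\ell)$ of positive integers summing to $n$ (the empty composition is the composition of $0$ with $0$ parts). An Arndt composition is one with $\sigma_{2i-1}>\sigma_{2i}$ for every positive integer $i$ with $2i\le\ell$. -}

module Defs where

open import Data.Nat using (ℕ; zero; suc; _+_; _∸_; _<_; _>_; _>?_)
open import Data.List using (List; []; _∷_; length; filter; concatMap; map; sum)
open import Data.List.Relation.Unary.All using (All)
open import Data.Product using (_×_; _,_)
open import Data.Unit using (⊤; tt)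
open import Relation.Nullary using (Dec; yes; no)
open import Relation.Nullary.Decidable using (_×-dec_)

oneTo : ℕ → List ℕ
oneTo zero = []
oneTo (suc n) = oneTo n Data.List.++ (suc n ∷ [])

compositions : ℕ → ℕ → List (List ℕ)
compositions zero zero = [] ∷ []
compositions (suc n) zero = []
compositions n (suc m) = concatMap (λ k → map (k ∷_) (compositions (n ∸ k) m)) (oneTo n)

Arndt : List ℕ → Set
Arndt [] = ⊤
Arndt (x ∷ []) = ⊤
Arndt (x ∷ y ∷ rest) = (x > y) × Arndt rest

arndt? : (σ : List ℕ) → Dec (Arndt σ)
arndt? [] = yes tt
arndt? (x ∷ []) = yes tt
arndt? (x ∷ y ∷ rest) = (x >? y) ×-dec arndt? rest

a : ℕ → ℕ → ℕ
a n m = length (filter arndt? (compositions n m))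

{-# OPTIONS --safe #-}
-- Splitting off the first two parts k > j ≥ 1 gives a(n, m + 2) = Σ a(n - k - j, m), i.e.
-- A_{m+2}(z) = z³ A_m(z) / ((1 - z) (1 - z²)) on generating functions, so b = a(·, m + 2)
-- satisfies b(n + 3) - b(n + 2) - b(n + 1) + b(n) = a(n, m). With this, the recurrence with
-- parameters (m + 2, ⌊m/2⌋ + 1) at n + 3 is a fixed integer combination of itself at n + 2,
-- n + 1, n and of the recurrence with parameters (m, ⌊m/2⌋) at n. It therefore propagates
-- from m to m + 2 once n = 0, 1, 2 are checked, starting from a(n, 0) = [n = 0] and
-- a(n, 1) = [n ≥ 1].
module Submission where

open import Defs
open import Data.Nat using (ℕ; _/_)
open import Data.Integer using (ℤ; +_; _+_; _-_; _*_)
open import Relation.Binary.PropositionalEquality using (_≡_)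

import Data.Nat as ℕ
open import Data.Nat using (zero; suc; _∸_; _<_; _<ᵇ_; s≤s; z≤n)
import Data.Nat.Properties as ℕₚ
open import Data.Nat.DivMod using (m/n≡1+[m∸n]/n)
import Data.Integer.Properties as ℤₚ
import Data.Nat.Tactic.RingSolver as ℕ-Solver
import Data.Integer.Tactic.RingSolver as ℤ-Solver
open import Algebra.Properties.CommutativeSemigroup ℕₚ.+-commutativeSemigroup using (interchange)
open import Data.Bool using (true; false; if_then_else_)
open import Data.List using (List; []; _∷_; _++_; length; filter; concatMap; map)
open import Data.Nat.ListAction using (sum)
open import Data.Nat.ListAction.Properties using (sum-++)
import Data.List.Properties as List
open import Data.List.Relation.Unary.All using (universal)
open import Data.List.Relation.Unary.All.Properties using (map⁺)
open import Data.Product using (_,_; proj₁; proj₂)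
open import Function using (_∘_)
open import Relation.Nullary using (Dec; yes; no; ¬_)
open import Relation.Nullary.Reflects using (ofʸ; ofⁿ)
open import Relation.Binary.PropositionalEquality
  using (refl; sym; trans; cong; cong₂; subst; module ≡-Reasoning)
open ≡-Reasoning

-- f 1 + ⋯ + f r; peeling off f 1 first makes reindexing by suc definitional.
sumTo : (ℕ → ℕ) → ℕ → ℕ
sumTo f zero    = 0
sumTo f (suc r) = f 1 ℕ.+ sumTo (f ∘ suc) r

sumTo-suc : ∀ f r → sumTo f (suc r) ≡ sumTo f r ℕ.+ f (suc r)
sumTo-suc f zero    = ℕₚ.+-comm (f 1) 0
sumTo-suc f (suc r) = trans (cong (f 1 ℕ.+_) (sumTo-suc (f ∘ suc) r)) (sym (ℕₚ.+-assoc (f 1) _ _))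

sumTo-cong : ∀ {f g} r → (∀ x → x < r → f (suc x) ≡ g (suc x)) → sumTo f r ≡ sumTo g r
sumTo-cong zero    eq = refl
sumTo-cong (suc r) eq = cong₂ ℕ._+_ (eq 0 (s≤s z≤n)) (sumTo-cong r (λ x x<r → eq (suc x) (s≤s x<r)))

sumTo-zeros : ∀ f r → (∀ x → f (suc x) ≡ 0) → sumTo f r ≡ 0
sumTo-zeros f zero    eq = refl
sumTo-zeros f (suc r) eq = cong₂ ℕ._+_ (eq 0) (sumTo-zeros (f ∘ suc) r (eq ∘ suc))

sumTo-+ : ∀ f g r → sumTo (λ x → f x ℕ.+ g x) r ≡ sumTo f r ℕ.+ sumTo g r
sumTo-+ f g zero    = refl
sumTo-+ f g (suc r) =
  trans (cong (f 1 ℕ.+ g 1 ℕ.+_) (sumTo-+ (f ∘ suc) (g ∘ suc) r)) (interchange (f 1) (g 1) _ _)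

sum-map-oneTo : ∀ f r → sum (map f (oneTo r)) ≡ sumTo f r
sum-map-oneTo f zero    = refl
sum-map-oneTo f (suc r) = begin
  sum (map f (oneTo r ++ suc r ∷ []))       ≡⟨ cong sum (List.map-++ f (oneTo r) _) ⟩
  sum (map f (oneTo r) ++ f (suc r) ∷ [])   ≡⟨ sum-++ (map f (oneTo r)) _ ⟩
  sum (map f (oneTo r)) ℕ.+ (f (suc r) ℕ.+ 0) ≡⟨ cong₂ ℕ._+_ (sum-map-oneTo f r) (ℕₚ.+-identityʳ _) ⟩
  sumTo f r ℕ.+ f (suc r)                   ≡⟨ sumTo-suc f r ⟨
  sumTo f (suc r)                           ∎

#arndt : List (List ℕ) → ℕ
#arndt = length ∘ filter arndt?

#arndt-concatMap-oneTo : ∀ (g : ℕ → List (List ℕ)) r → #arndt (concatMap g (oneTo r)) ≡ sumTo (#arndt ∘ g) r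
#arndt-concatMap-oneTo g r = trans (#arndt-concatMap (oneTo r)) (sum-map-oneTo (#arndt ∘ g) r)
  where
  #arndt-concatMap : ∀ xs → #arndt (concatMap g xs) ≡ sum (map (#arndt ∘ g) xs)
  #arndt-concatMap []       = refl
  #arndt-concatMap (x ∷ xs) = begin
    length (filter arndt? (g x ++ concatMap g xs))
      ≡⟨ cong length (List.filter-++ arndt? (g x) (concatMap g xs)) ⟩
    length (filter arndt? (g x) ++ filter arndt? (concatMap g xs))
      ≡⟨ List.length-++ (filter arndt? (g x)) ⟩
    #arndt (g x) ℕ.+ #arndt (concatMap g xs)
      ≡⟨ cong (#arndt (g x) ℕ.+_) (#arndt-concatMap xs) ⟩
    #arndt (g x) ℕ.+ sum (map (#arndt ∘ g) xs) ∎

#arndt-pair-desc : ∀ {k j} → j < k → ∀ L → #arndt (map (k ∷_) (map (j ∷_) L)) ≡ #arndt L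
#arndt-pair-desc j<k []      = refl
#arndt-pair-desc {k} {j} j<k (σ ∷ L) = by-cases (arndt? σ)
  where
  by-cases : Dec (Arndt σ) → #arndt (map (k ∷_) (map (j ∷_) (σ ∷ L))) ≡ #arndt (σ ∷ L)
  by-cases (yes σ-arndt) = begin
    #arndt ((k ∷ j ∷ σ) ∷ map (k ∷_) (map (j ∷_) L))
      ≡⟨ cong length (List.filter-accept arndt? {x = k ∷ j ∷ σ} (j<k , σ-arndt)) ⟩
    suc (#arndt (map (k ∷_) (map (j ∷_) L))) ≡⟨ cong suc (#arndt-pair-desc j<k L) ⟩
    suc (#arndt L)                            ≡⟨ cong length (List.filter-accept arndt? σ-arndt) ⟨
    #arndt (σ ∷ L)                            ∎
  by-cases (no σ-not) = begin
    #arndt ((k ∷ j ∷ σ) ∷ map (k ∷_) (map (j ∷_) L))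
      ≡⟨ cong length (List.filter-reject arndt? {x = k ∷ j ∷ σ} (σ-not ∘ proj₂)) ⟩
    #arndt (map (k ∷_) (map (j ∷_) L))        ≡⟨ #arndt-pair-desc j<k L ⟩
    #arndt L                                  ≡⟨ cong length (List.filter-reject arndt? σ-not) ⟨
    #arndt (σ ∷ L)                            ∎

#arndt-pair-nondesc : ∀ {k j} → ¬ j < k → ∀ L → #arndt (map (k ∷_) (map (j ∷_) L)) ≡ 0
#arndt-pair-nondesc j≮k L =
  cong length (List.filter-none arndt? (map⁺ (map⁺ (universal (λ _ → j≮k ∘ proj₁) L))))

#arndt-pair : ∀ k j L → #arndt (map (k ∷_) (map (j ∷_) L)) ≡ (if j <ᵇ k then #arndt L else 0)
#arndt-pair k j L with j <ᵇ k | ℕₚ.<ᵇ-reflects-< j k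
... | true  | ofʸ j<k = #arndt-pair-desc j<k L
... | false | ofⁿ j≮k = #arndt-pair-nondesc j≮k L

compositions-suc : ∀ n m →
  compositions n (suc m) ≡ concatMap (λ k → map (k ∷_) (compositions (n ∸ k) m)) (oneTo n)
compositions-suc zero    m = refl
compositions-suc (suc n) m = refl

a-suc : ∀ n m → a n (suc m) ≡ sumTo (λ k → #arndt (map (k ∷_) (compositions (n ∸ k) m))) n
a-suc n m = trans (cong #arndt (compositions-suc n m)) (#arndt-concatMap-oneTo _ n)

a-one : ∀ n → a (suc n) 1 ≡ 1
a-one n = begin
  a (suc n) 1
    ≡⟨ a-suc (suc n) 0 ⟩
  sumTo firstPart (suc n)
    ≡⟨ sumTo-cong {firstPart} {isZero ∘ (suc n ∸_)} (suc n) (λ x _ → #arndt-one-part (suc x) (n ∸ x)) ⟩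
  sumTo (isZero ∘ (suc n ∸_)) (suc n)
    ≡⟨ last-only n ⟩
  1 ∎
  where
  firstPart : ℕ → ℕ
  firstPart k = #arndt (map (k ∷_) (compositions (suc n ∸ k) 0))
  isZero : ℕ → ℕ
  isZero zero    = 1
  isZero (suc _) = 0
  #arndt-one-part : ∀ k r → #arndt (map (k ∷_) (compositions r 0)) ≡ isZero r
  #arndt-one-part k zero    = refl
  #arndt-one-part k (suc r) = refl
  last-only : ∀ n → sumTo (λ k → isZero (suc n ∸ k)) (suc n) ≡ 1
  last-only zero    = refl
  last-only (suc n) = last-only n

pairsFrom : (ℕ → ℕ) → ℕ → ℕ → ℕ
pairsFrom c k r = sumTo (λ j → if j <ᵇ k then c (r ∸ j) else 0) r

prependPairs : (ℕ → ℕ) → ℕ → ℕ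
prependPairs c n = sumTo (λ k → pairsFrom c k (n ∸ k)) n

#arndt-prepend : ∀ k r m → #arndt (map (k ∷_) (compositions r (suc m))) ≡ pairsFrom (λ r → a r m) k r
#arndt-prepend k r m = begin
  #arndt (map (k ∷_) (compositions r (suc m)))
    ≡⟨ cong (#arndt ∘ map (k ∷_)) (compositions-suc r m) ⟩
  #arndt (map (k ∷_) (concatMap (λ j → map (j ∷_) (compositions (r ∸ j) m)) (oneTo r)))
    ≡⟨ cong #arndt (List.map-concatMap (k ∷_) _ (oneTo r)) ⟩
  #arndt (concatMap (λ j → map (k ∷_) (map (j ∷_) (compositions (r ∸ j) m))) (oneTo r))
    ≡⟨ #arndt-concatMap-oneTo _ r ⟩
  sumTo (λ j → #arndt (map (k ∷_) (map (j ∷_) (compositions (r ∸ j) m)))) r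
    ≡⟨ sumTo-cong r (λ j _ → #arndt-pair k (suc j) (compositions (r ∸ suc j) m)) ⟩
  pairsFrom (λ r → a r m) k r ∎

a-suc-suc : ∀ n m → a n (suc (suc m)) ≡ prependPairs (λ r → a r m) n
a-suc-suc n m = trans (a-suc n (suc m)) (sumTo-cong n (λ k _ → #arndt-prepend (suc k) (n ∸ suc k) m))

sumBelow : (ℕ → ℕ) → ℕ → ℕ
sumBelow c n = sumTo (λ x → c (n ∸ x)) n

prependPairs-suc-suc : ∀ c n → prependPairs c (2 ℕ.+ n) ≡ prependPairs c n ℕ.+ sumBelow c n
prependPairs-suc-suc c n = begin
  pairsFrom c 1 (1 ℕ.+ n) ℕ.+ sumTo (λ k → pairsFrom c (suc k) (suc n ∸ k)) (suc n)
    ≡⟨ cong₂ ℕ._+_ (sumTo-zeros (λ j → if j <ᵇ 1 then c (suc n ∸ j) else 0) (suc n) (λ _ → refl))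
                   (sumTo-suc _ n) ⟩
  sumTo (λ k → pairsFrom c (suc k) (suc n ∸ k)) n ℕ.+ pairsFrom c (2 ℕ.+ n) (n ∸ n)
    ≡⟨ cong₂ ℕ._+_ (sumTo-cong n shift) (cong (pairsFrom c (2 ℕ.+ n)) (ℕₚ.n∸n≡0 n)) ⟩
  sumTo (λ k → c (n ∸ k) ℕ.+ pairsFrom c k (n ∸ k)) n ℕ.+ 0
    ≡⟨ ℕₚ.+-identityʳ _ ⟩
  sumTo (λ k → c (n ∸ k) ℕ.+ pairsFrom c k (n ∸ k)) n
    ≡⟨ sumTo-+ _ _ n ⟩
  sumBelow c n ℕ.+ prependPairs c n
    ≡⟨ ℕₚ.+-comm (sumBelow c n) _ ⟩
  prependPairs c n ℕ.+ sumBelow c n ∎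
  where
  shift : ∀ x → x < n →
    pairsFrom c (2 ℕ.+ x) (n ∸ x) ≡ c (n ∸ suc x) ℕ.+ pairsFrom c (suc x) (n ∸ suc x)
  shift x x<n = cong (pairsFrom c (2 ℕ.+ x)) (ℕₚ.+-∸-assoc 1 x<n)

-- On generating functions: (1 - z) (1 - z²) B′(z) = z³ B(z).
record PairExtension (b b′ : ℕ → ℕ) : Set where
  field
    initial₀ : b′ 0 ≡ 0
    initial₁ : b′ 1 ≡ 0
    initial₂ : b′ 2 ≡ 0
    step     : ∀ k → b′ (3 ℕ.+ k) ℕ.+ b′ k ≡ b′ (2 ℕ.+ k) ℕ.+ b′ (1 ℕ.+ k) ℕ.+ b k

module _ {b b′ : ℕ → ℕ} (E : PairExtension b b′) where
  open PairExtension E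

  initial₃ : b′ 3 ≡ b 0
  initial₃ = begin
    b′ 3                   ≡⟨ ℕₚ.+-identityʳ _ ⟨
    b′ 3 ℕ.+ 0             ≡⟨ cong (b′ 3 ℕ.+_) initial₀ ⟨
    b′ 3 ℕ.+ b′ 0          ≡⟨ step 0 ⟩
    b′ 2 ℕ.+ b′ 1 ℕ.+ b 0  ≡⟨ cong₂ (λ x y → x ℕ.+ y ℕ.+ b 0) initial₂ initial₁ ⟩
    b 0                    ∎

  initial₄ : b′ 4 ≡ b 0 ℕ.+ b 1
  initial₄ = begin
    b′ 4                   ≡⟨ ℕₚ.+-identityʳ _ ⟨
    b′ 4 ℕ.+ 0             ≡⟨ cong (b′ 4 ℕ.+_) initial₁ ⟨
    b′ 4 ℕ.+ b′ 1          ≡⟨ step 1 ⟩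
    b′ 3 ℕ.+ b′ 2 ℕ.+ b 1  ≡⟨ cong₂ (λ x y → x ℕ.+ y ℕ.+ b 1) initial₃ initial₂ ⟩
    b 0 ℕ.+ 0 ℕ.+ b 1      ≡⟨ cong (ℕ._+ b 1) (ℕₚ.+-identityʳ (b 0)) ⟩
    b 0 ℕ.+ b 1            ∎

pairExtension-resp : ∀ {b c c′} → (∀ n → c n ≡ c′ n) → PairExtension b c → PairExtension b c′
pairExtension-resp {b} {c} {c′} eq E = record
  { initial₀ = trans (sym (eq 0)) initial₀
  ; initial₁ = trans (sym (eq 1)) initial₁
  ; initial₂ = trans (sym (eq 2)) initial₂
  ; step     = λ k → trans (cong₂ ℕ._+_ (sym (eq _)) (sym (eq k)))
                       (trans (step k) (cong (ℕ._+ b k) (cong₂ ℕ._+_ (eq _) (eq _))))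
  }
  where open PairExtension E

prependPairs-pairExtension : ∀ c → PairExtension c (prependPairs c)
prependPairs-pairExtension c = record
  { initial₀ = refl ; initial₁ = refl ; initial₂ = refl ; step = step }
  where
  P = prependPairs c
  step : ∀ k → P (3 ℕ.+ k) ℕ.+ P k ≡ P (2 ℕ.+ k) ℕ.+ P (1 ℕ.+ k) ℕ.+ c k
  step k = begin
    P (3 ℕ.+ k) ℕ.+ P k
      ≡⟨ cong (ℕ._+ P k) (prependPairs-suc-suc c (suc k)) ⟩
    P (1 ℕ.+ k) ℕ.+ (c k ℕ.+ sumBelow c k) ℕ.+ P k
      ≡⟨ rearrange (P (1 ℕ.+ k)) (c k) (sumBelow c k) (P k) ⟩
    P k ℕ.+ sumBelow c k ℕ.+ P (1 ℕ.+ k) ℕ.+ c k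
      ≡⟨ cong (λ z → z ℕ.+ P (1 ℕ.+ k) ℕ.+ c k) (prependPairs-suc-suc c k) ⟨
    P (2 ℕ.+ k) ℕ.+ P (1 ℕ.+ k) ℕ.+ c k ∎
    where
    rearrange : ∀ p₁ x s p₀ → p₁ ℕ.+ (x ℕ.+ s) ℕ.+ p₀ ≡ p₀ ℕ.+ s ℕ.+ p₁ ℕ.+ x
    rearrange = ℕ-Solver.solve-∀

a-pairExtension : ∀ m → PairExtension (λ n → a n m) (λ n → a n (2 ℕ.+ m))
a-pairExtension m = pairExtension-resp (λ n → sym (a-suc-suc n m)) (prependPairs-pairExtension _)

recurrenceAt : ℕ → ℕ → (ℕ → ℤ) → ℕ → ℤ
recurrenceAt m h f n = (+ m - + n - + 2 + + h) * f (2 ℕ.+ n) + (+ m - + h) * f (1 ℕ.+ n) + + n * f n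

Recurrence : ℕ → ℕ → (ℕ → ℤ) → Set
Recurrence m h f = ∀ n → recurrenceAt m h f n ≡ + 0

recurrenceAt-cong : ∀ m h {f g} n → f (2 ℕ.+ n) ≡ g (2 ℕ.+ n) → f (1 ℕ.+ n) ≡ g (1 ℕ.+ n) → f n ≡ g n →
  recurrenceAt m h f n ≡ recurrenceAt m h g n
recurrenceAt-cong m h n e₂ e₁ e₀ =
  cong₂ _+_ (cong₂ _+_ (cong ((+ m - + n - + 2 + + h) *_) e₂) (cong ((+ m - + h) *_) e₁)) (cong (+ n *_) e₀)

pairDifference : (ℕ → ℤ) → ℕ → ℤ
pairDifference f k = f (3 ℕ.+ k) + f k - f (2 ℕ.+ k) - f (1 ℕ.+ k)

pairDifference-extension : ∀ {b b′} → PairExtension b b′ → ∀ k → pairDifference (λ n → + b′ n) k ≡ + b k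
pairDifference-extension {b} {b′} E k = begin
  + b′ (3 ℕ.+ k) + + b′ k - + b′ (2 ℕ.+ k) - + b′ (1 ℕ.+ k)
    ≡⟨ cong (λ z → z - + b′ (2 ℕ.+ k) - + b′ (1 ℕ.+ k)) (cong +_ (PairExtension.step E k)) ⟩
  + b′ (2 ℕ.+ k) + + b′ (1 ℕ.+ k) + + b k - + b′ (2 ℕ.+ k) - + b′ (1 ℕ.+ k)
    ≡⟨ cancel (+ b′ (2 ℕ.+ k)) (+ b′ (1 ℕ.+ k)) (+ b k) ⟩
  + b k ∎
  where
  cancel : ∀ x y z → x + y + z - x - y ≡ z
  cancel = ℤ-Solver.solve-∀

recurrenceAt-shift : ∀ m h f n →
  recurrenceAt (2 ℕ.+ m) (1 ℕ.+ h) f (3 ℕ.+ n)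
    ≡ recurrenceAt (2 ℕ.+ m) (1 ℕ.+ h) f (2 ℕ.+ n) + recurrenceAt (2 ℕ.+ m) (1 ℕ.+ h) f (1 ℕ.+ n)
      - recurrenceAt (2 ℕ.+ m) (1 ℕ.+ h) f n + recurrenceAt m h (pairDifference f) n
recurrenceAt-shift m h f n =
  identity (+ m) (+ h) (+ n) (f n) (f (1 ℕ.+ n)) (f (2 ℕ.+ n)) (f (3 ℕ.+ n)) (f (4 ℕ.+ n)) (f (5 ℕ.+ n))
  where
  identity : ∀ m h x f₀ f₁ f₂ f₃ f₄ f₅ →
    (+ 2 + m - (+ 3 + x) - + 2 + (+ 1 + h)) * f₅ + (+ 2 + m - (+ 1 + h)) * f₄ + (+ 3 + x) * f₃
      ≡ ((+ 2 + m - (+ 2 + x) - + 2 + (+ 1 + h)) * f₄ + (+ 2 + m - (+ 1 + h)) * f₃ + (+ 2 + x) * f₂)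
        + ((+ 2 + m - (+ 1 + x) - + 2 + (+ 1 + h)) * f₃ + (+ 2 + m - (+ 1 + h)) * f₂ + (+ 1 + x) * f₁)
        - ((+ 2 + m - x - + 2 + (+ 1 + h)) * f₂ + (+ 2 + m - (+ 1 + h)) * f₁ + x * f₀)
        + ((m - x - + 2 + h) * (f₅ + f₂ - f₄ - f₃) + (m - h) * (f₄ + f₁ - f₃ - f₂)
           + x * (f₃ + f₀ - f₂ - f₁))
  identity = ℤ-Solver.solve-∀

-- The two numerical hypotheses are the instances n = 1, 2 of the conclusion, rewritten with
-- b′ 3 = b 0 and b′ 4 = b 0 + b 1.
recurrence-pairExtension : ∀ {m h b b′} → PairExtension b b′ →
  (+ m + + h) * + b 0 ≡ + 0 →
  (+ m + + h - + 1) * (+ b 0 + + b 1) + (+ m - + h + + 1) * + b 0 ≡ + 0 →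
  Recurrence m h (λ n → + b n) → Recurrence (2 ℕ.+ m) (1 ℕ.+ h) (λ n → + b′ n)
recurrence-pairExtension {m} {h} {b} {b′} E at₁ at₂ R = go
  where
  open PairExtension E using (initial₁; initial₂)
  base₀ : ∀ m h z → (m - + 0 - + 2 + h) * + 0 + (m - h) * + 0 + + 0 * z ≡ + 0
  base₀ = ℤ-Solver.solve-∀
  base₁ : ∀ m h x → (+ 2 + m - + 1 - + 2 + (+ 1 + h)) * x + (+ 2 + m - (+ 1 + h)) * + 0 + + 1 * + 0
    ≡ (m + h) * x
  base₁ = ℤ-Solver.solve-∀
  base₂ : ∀ m h x y → (+ 2 + m - + 2 - + 2 + (+ 1 + h)) * (x + y) + (+ 2 + m - (+ 1 + h)) * x + + 2 * + 0
    ≡ (m + h - + 1) * (x + y) + (m - h + + 1) * x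
  base₂ = ℤ-Solver.solve-∀
  go : Recurrence (2 ℕ.+ m) (1 ℕ.+ h) (λ n → + b′ n)
  go 0 rewrite initial₁ | initial₂ = base₀ (+ (2 ℕ.+ m)) (+ (1 ℕ.+ h)) (+ b′ 0)
  go 1 rewrite initial₁ | initial₂ | initial₃ E = trans (base₁ (+ m) (+ h) (+ b 0)) at₁
  go 2 rewrite initial₂ | initial₃ E | initial₄ E = trans (base₂ (+ m) (+ h) (+ b 0) (+ b 1)) at₂
  go (suc (suc (suc n))) = begin
    recurrenceAt (2 ℕ.+ m) (1 ℕ.+ h) f′ (3 ℕ.+ n)
      ≡⟨ recurrenceAt-shift m h f′ n ⟩
    recurrenceAt (2 ℕ.+ m) (1 ℕ.+ h) f′ (2 ℕ.+ n) + recurrenceAt (2 ℕ.+ m) (1 ℕ.+ h) f′ (1 ℕ.+ n)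
      - recurrenceAt (2 ℕ.+ m) (1 ℕ.+ h) f′ n + recurrenceAt m h (pairDifference f′) n
      ≡⟨ cong₂ _+_ (cong₂ _-_ (cong₂ _+_ (go (suc (suc n))) (go (suc n))) (go n)) (trans Δ≡b (R n)) ⟩
    + 0 ∎
    where
    f′ = λ n → + b′ n
    Δ = pairDifference-extension E
    Δ≡b : recurrenceAt m h (pairDifference f′) n ≡ recurrenceAt m h (λ n → + b n) n
    Δ≡b = recurrenceAt-cong m h {pairDifference f′} {λ n → + b n} n (Δ (2 ℕ.+ n)) (Δ (1 ℕ.+ n)) (Δ n)

half-suc-suc : ∀ m → (2 ℕ.+ m) / 2 ≡ 1 ℕ.+ m / 2
half-suc-suc m = m/n≡1+[m∸n]/n {2 ℕ.+ m} {2} (s≤s (s≤s z≤n))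

a-recurrence : ∀ m → Recurrence m (m / 2) (λ n → + a n m)
a-recurrence 0 0             = refl
a-recurrence 0 (suc n)       = vanish (+ 0) (+ 0) (+ suc n)
  where
  vanish : ∀ m h x → (m - x - + 2 + h) * + 0 + (m - h) * + 0 + x * + 0 ≡ + 0
  vanish = ℤ-Solver.solve-∀
a-recurrence 1 0             = refl
a-recurrence 1 (suc n)       =
  trans (recurrenceAt-cong 1 0 {λ k → + a k 1} {λ _ → + 1} (suc n)
           (cong +_ (a-one (2 ℕ.+ n))) (cong +_ (a-one (1 ℕ.+ n))) (cong +_ (a-one n)))
        (constant (+ n))
  where
  constant : ∀ x → (+ 1 - (+ 1 + x) - + 2 + + 0) * + 1 + (+ 1 - + 0) * + 1 + (+ 1 + x) * + 1 ≡ + 0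
  constant = ℤ-Solver.solve-∀
a-recurrence (suc (suc m))   =
  subst (λ h → Recurrence (2 ℕ.+ m) h (λ n → + a n (2 ℕ.+ m))) (sym (half-suc-suc m))
    (recurrence-pairExtension (a-pairExtension m) (at₁ m) (at₂ m) (a-recurrence m))
  where
  at₁ : ∀ m → (+ m + + (m / 2)) * + a 0 m ≡ + 0
  at₁ zero    = refl
  at₁ (suc m) = ℤₚ.*-zeroʳ (+ suc m + + (suc m / 2))
  at₂ : ∀ m → (+ m + + (m / 2) - + 1) * (+ a 0 m + + a 1 m) + (+ m - + (m / 2) + + 1) * + a 0 m ≡ + 0
  at₂ 0             = refl
  at₂ 1             = refl
  at₂ (suc (suc m)) = cong₂ _+_ (ℤₚ.*-zeroʳ (+ (2 ℕ.+ m) + + ((2 ℕ.+ m) / 2) - + 1))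
                                          (ℤₚ.*-zeroʳ (+ (2 ℕ.+ m) - + ((2 ℕ.+ m) / 2) + + 1))

theorem2p4 : (n m : ℕ) →
    (((+ m) - (+ n) - + 2 + + (m / 2)) * + (a (n Data.Nat.+ 2) m))
      + (((+ m) - + (m / 2)) * + (a (n Data.Nat.+ 1) m))
      + ((+ n) * + (a n m)) ≡ + 0
theorem2p4 n m rewrite ℕₚ.+-comm n 2 | ℕₚ.+-comm n 1 = a-recurrence m n
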